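{- Let $t\ge 3$ and let $n_1,\dots,n_t$ be integers with $n_i\ge 2t+1$ for all $i$, and set $G=K_{n_1}\times\cdots\times K_{n_t}$. For all nonnegative integers $a,b$, $$\gamma_{\mathrm{pr}}\big(G^{\,\cdot a}\times G^{\,\cdot b}\big)\le 2^{a+b}\big((a+2)t+2a+2\big)+2^b\,b\,(t+a+2).$$
   Context: $K_n$ is the complete graph on $n$ vertices. The direct product $G\times H$ has vertex set $V(G)\times V(H)$, with $(u_G,u_H)$ adjacent to $(v_G,v_H)$ iff $u_Gv_G\in E(G)$ and $u_Hv_H\in E(H)$; iterated products are taken associatively. For a vertex-transitive graph $G$ (such as a direct product of complete graphs) and a positive integer $\ell$, $G^{\,\cdot\ell}$ denotes the graph obtained from $G$ by taking a disjoint path on $\ell$ vertices and adding one edge joining an endpoint of the path to a vertex of $G$ (well defined up to isomorphism); $G^{\,\cdot 0}=G$. A set $D$ is dominating if every vertex is in $D$ or adjacent to a vertex of $D$. For a graph without isolated vertices, $\gamma_{\mathrm{pr}}$ is the minimum size of a dominating set whose induced subgraph has a perfect matching. -}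

module Defs where

open import Level using (0ℓ)
open import Data.Nat using (ℕ; zero; suc; _+_; _*_; _^_; _≤_)
open import Data.Fin using (Fin; toℕ)
open import Data.Vec using (Vec; []; _∷_)
open import Data.List using (List; []; _∷_; length)
open import Data.List.Relation.Unary.Any using (Any)
open import Data.List.Relation.Unary.All using (All)
open import Data.List.Relation.Unary.Unique.Propositional using (Unique)
open import Data.List.Membership.Propositional using (_∈_)
open import Data.Product using (_×_; _,_; proj₁; proj₂)
open import Data.Sum using (_⊎_; inj₁; inj₂)
open import Data.Empty using (⊥)
open import Relation.Binary.PropositionalEquality using (_≡_)
open import Relation.Nullary using (¬_)

record Graph : Set₁ where
  field
    V   : Set
    Adj : V → V → Set
open Graph public

K : ℕ → Graph
K n = record { V = Fin n ; Adj = λ i j → ¬ (i ≡ j) }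

_×ᵍ_ : Graph → Graph → Graph
G ×ᵍ H = record
  { V   = V G × V H
  ; Adj = λ u v → Adj G (proj₁ u) (proj₁ v) × Adj H (proj₂ u) (proj₂ v) }

-- K_{n_1} × ... × K_{n_t}  (t = suc k ≥ 1), associated to the right.
KProd : ∀ {k} → Vec ℕ (suc k) → Graph
KProd {zero}  (n ∷ [])     = K n
KProd {suc k} (n ∷ ns)     = K n ×ᵍ KProd ns

PathAdj : ∀ {ℓ} → Fin ℓ → Fin ℓ → Set
PathAdj i j = (toℕ j ≡ suc (toℕ i)) ⊎ (toℕ i ≡ suc (toℕ j))

-- G^{·ℓ}: G plus a disjoint path on ℓ vertices (Fin ℓ), with one extra edge
-- joining the path endpoint 0 to the chosen vertex v₀ of G.
attach : (G : Graph) → V G → ℕ → Graph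
attach G v₀ ℓ = record { V = V G ⊎ Fin ℓ ; Adj = A }
  where
  A : V G ⊎ Fin ℓ → V G ⊎ Fin ℓ → Set
  A (inj₁ u) (inj₁ v) = Adj G u v
  A (inj₂ i) (inj₂ j) = PathAdj i j
  A (inj₁ u) (inj₂ j) = (u ≡ v₀) × (toℕ j ≡ 0)
  A (inj₂ i) (inj₁ v) = (v ≡ v₀) × (toℕ i ≡ 0)

flatten : {A : Set} → List (A × A) → List A
flatten []             = []
flatten ((x , y) ∷ ps) = x ∷ y ∷ flatten ps

-- A paired dominating set: a set D (= vertices of `pairs`) whose induced
-- subgraph has the perfect matching `pairs` (edges of G, pairwise disjoint,
-- covering D exactly), and D dominates G.
record PairedDomSet (G : Graph) : Set where
  field
    pairs     : List (V G × V G)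
    matched   : All (λ p → Adj G (proj₁ p) (proj₂ p)) pairs
    distinct  : Unique (flatten pairs)
    dominates : ∀ w → (w ∈ flatten pairs) ⊎ Any (Adj G w) (flatten pairs)
  carrier : List (V G)
  carrier = flatten pairs
  size : ℕ
  size = length carrier

γpr≤ : Graph → ℕ → Set
γpr≤ G m = Data.Product.Σ (PairedDomSet G) (λ D → PairedDomSet.size D ≤ m)

-- Write G = K_{n₁} × ⋯ × K_{n_t} and M = 2t + 1.  Through every vertex of G runs a clique of
-- M vertices, pairwise distinct in every coordinate, such that each vertex of G is adjacent to
-- all but at most t of them: it agrees with at most one member in each coordinate.  Take such
-- cliques α through u and β through v.  The diagonal vertices (α j, β j), plus one extra vertex,
-- are matched in G × G and dominate it, since a pair (g, g') misses at most 2t < M indices.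
-- Every other vertex has a path coordinate.  Pairing consecutive vertices of the path at u, and
-- pairing up 2t − 2 further members of α, gives a matching of G^{·a} in which every vertex has a
-- neighbour; in G^{·b} the path at v and 2t − 2 members of β give matchings in which every path
-- vertex, resp. every vertex of G, has a neighbour.  For matchings P and Q the diagonals of the
-- 2 × 2 blocks {x₁, x₂} × {y₁, y₂} match P × Q in the direct product, and if every x has a
-- neighbour in P and every y one in Q then every (x, y) has one in P × Q.  Two such products
-- cover the vertices with a path coordinate; counting gives a bound far below the stated one.

module Submission where

open import Defs
open import Data.Nat using (ℕ; zero; suc; _+_; _*_; _^_; _≤_; _<_; z≤n; s≤s; s≤s⁻¹; ⌊_/2⌋; ⌈_/2⌉)
open import Data.Nat.Properties
open import Data.Nat.Tactic.RingSolver using (solve-∀)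
open import Data.Fin using (Fin; zero; suc; inject₁; inject≤; _↑ʳ_)
open import Data.Fin.Properties
  using (toℕ-inject₁; inject≤-injective; ↑ʳ-injective; injective⇒≤; ¬∀⟶∃¬; any?)
  renaming (_≟_ to _≟ᶠ_)
import Data.Fin.Permutation.Components as PC
open import Data.Vec using (Vec; []; _∷_; lookup)
open import Data.List using (List; []; _∷_; _++_; length; map; tabulate; cartesianProduct)
  renaming (lookup to lookupᴸ)
open import Data.List.Properties using (length-++; length-map; length-tabulate; ++-assoc)
open import Data.List.Membership.Propositional using (_∈_; _∉_; lose)
open import Data.List.Membership.Propositional.Properties
  using (∈-++⁺ˡ; ∈-++⁺ʳ; ∈-++⁻; ∈-tabulate⁻; ∈-cartesianProduct⁻)
open import Data.List.Relation.Unary.Any using (Any; here; there; index)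
open import Data.List.Relation.Unary.Any.Properties using (lookup-index; cartesianProduct⁺)
import Data.List.Relation.Unary.Any.Properties as Any
open import Data.List.Relation.Unary.All using (All; []; _∷_)
import Data.List.Relation.Unary.All as All
import Data.List.Relation.Unary.All.Properties as All
open import Data.List.Relation.Unary.AllPairs using ([]; _∷_)
import Data.List.Relation.Unary.AllPairs.Properties as AllPairs
open import Data.List.Relation.Unary.Linked using (Linked; []; [-]; _∷_)
open import Data.List.Relation.Unary.Linked.Properties using (AllPairs⇒Linked)
open import Data.List.Relation.Unary.Unique.Propositional using (Unique)
import Data.List.Relation.Unary.Unique.Propositional.Properties as Unique
open import Data.List.Relation.Binary.Disjoint.Propositional using (Disjoint)
open import Data.List.Relation.Binary.Permutation.Propositional
  using (_↭_; prep; swap; ↭-refl; ↭-sym; ↭⇒↭ₛ; module PermutationReasoning)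
open import Data.List.Relation.Binary.Permutation.Propositional.Properties
  using (++⁺; shifts; ↭-length; ∈-resp-↭; Any-resp-↭)
import Data.List.Relation.Binary.Permutation.Setoid.Properties as Permutationₛ
open import Data.Product using (Σ; ∃; _×_; _,_; proj₁; proj₂)
open import Data.Sum using (_⊎_; inj₁; inj₂)
import Data.Sum as Sum
open import Data.Sum.Properties using (inj₁-injective; inj₂-injective)
open import Data.Empty using (⊥-elim)
open import Function using (_∘_; id)
open import Function.Definitions using (Injective)
open import Relation.Nullary using (¬_; yes; no; contradiction)
open import Relation.Nullary.Decidable using (dec-true)
open import Relation.Binary.Definitions using (DecidableEquality)
open import Relation.Binary.PropositionalEquality
import Data.List.Membership.DecPropositional as DecMembership

private
  variable
    A B : Set
    G H : Graph

Symmetric : Graph → Set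
Symmetric G = ∀ x y → Adj G x y → Adj G y x

Irreflexive : Graph → Set
Irreflexive G = ∀ x → ¬ Adj G x x

K-symmetric : ∀ n → Symmetric (K n)
K-symmetric n x y x≢y = x≢y ∘ sym

K-irreflexive : ∀ n → Irreflexive (K n)
K-irreflexive n x x≢x = x≢x refl

×ᵍ-symmetric : Symmetric G → Symmetric H → Symmetric (G ×ᵍ H)
×ᵍ-symmetric symG symH (x₁ , x₂) (y₁ , y₂) (p , q) = symG x₁ y₁ p , symH x₂ y₂ q

KProd-symmetric : ∀ {k} (ns : Vec ℕ (suc k)) → Symmetric (KProd ns)
KProd-symmetric {zero}  (n ∷ []) = K-symmetric n
KProd-symmetric {suc k} (n ∷ ns) = ×ᵍ-symmetric (K-symmetric n) (KProd-symmetric ns)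

KProd-irreflexive : ∀ {k} (ns : Vec ℕ (suc k)) → Irreflexive (KProd ns)
KProd-irreflexive {zero}  (n ∷ []) = K-irreflexive n
KProd-irreflexive {suc k} (n ∷ ns) (x , _) (p , _) = K-irreflexive n x p

attach-symmetric : ∀ {z ℓ} → Symmetric G → Symmetric (attach G z ℓ)
attach-symmetric symG (inj₁ x) (inj₁ y) e = symG x y e
attach-symmetric symG (inj₁ x) (inj₂ j) e = e
attach-symmetric symG (inj₂ i) (inj₁ y) e = e
attach-symmetric symG (inj₂ i) (inj₂ j) e = Sum.swap e

Edge : (G : Graph) → V G × V G → Set
Edge G (x , y) = Adj G x y

flatten-++ : (P Q : List (A × A)) → flatten (P ++ Q) ≡ flatten P ++ flatten Q
flatten-++ []             Q = refl
flatten-++ ((x , y) ∷ P) Q = cong (λ l → x ∷ y ∷ l) (flatten-++ P Q)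

length-flatten-++ : (P Q : List (A × A)) →
                    length (flatten (P ++ Q)) ≡ length (flatten P) + length (flatten Q)
length-flatten-++ P Q = trans (cong length (flatten-++ P Q)) (length-++ (flatten P))

Any-flatten-++⁺ˡ : ∀ {P : A → Set} (Ps Qs : List (A × A)) →
                   Any P (flatten Ps) → Any P (flatten (Ps ++ Qs))
Any-flatten-++⁺ˡ Ps Qs p = subst (Any _) (sym (flatten-++ Ps Qs)) (Any.++⁺ˡ p)

Any-flatten-++⁺ʳ : ∀ {P : A → Set} (Ps Qs : List (A × A)) →
                   Any P (flatten Qs) → Any P (flatten (Ps ++ Qs))
Any-flatten-++⁺ʳ Ps Qs p = subst (Any _) (sym (flatten-++ Ps Qs)) (Any.++⁺ʳ (flatten Ps) p)

∈-flatten-++⁻ : ∀ {x} (Ps Qs : List (A × A)) → x ∈ flatten (Ps ++ Qs) → x ∈ flatten Ps ⊎ x ∈ flatten Qs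
∈-flatten-++⁻ {x = x} Ps Qs m = ∈-++⁻ (flatten Ps) (subst (x ∈_) (flatten-++ Ps Qs) m)

pairUp : List A → List (A × A)
pairUp []           = []
pairUp (x ∷ [])     = []
pairUp (x ∷ y ∷ xs) = (x , y) ∷ pairUp xs

∈-pairUp⁻ : ∀ {z} (xs : List A) → z ∈ flatten (pairUp xs) → z ∈ xs
∈-pairUp⁻ (x ∷ y ∷ xs) (here eq)         = here eq
∈-pairUp⁻ (x ∷ y ∷ xs) (there (here eq)) = there (here eq)
∈-pairUp⁻ (x ∷ y ∷ xs) (there (there m)) = there (there (∈-pairUp⁻ xs m))

Unique-pairUp : {xs : List A} → Unique xs → Unique (flatten (pairUp xs))
Unique-pairUp {xs = []}         _ = []
Unique-pairUp {xs = x ∷ []}     _ = []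
Unique-pairUp {xs = x ∷ y ∷ xs} ((x≢y ∷ x∉xs) ∷ y∉xs ∷ unique) =
  (x≢y ∷ restrict x∉xs) ∷ restrict y∉xs ∷ Unique-pairUp unique
  where
  restrict : ∀ {P} → All P xs → All P (flatten (pairUp xs))
  restrict p = All.tabulate (All.lookup p ∘ ∈-pairUp⁻ xs)

length-pairUp : (xs : List A) →
                length (flatten (pairUp xs)) ≡ ⌊ length xs /2⌋ + ⌊ length xs /2⌋
length-pairUp []           = refl
length-pairUp (x ∷ [])     = refl
length-pairUp (x ∷ y ∷ xs) = cong suc (trans (cong suc (length-pairUp xs)) (sym (+-suc h h)))
  where h = ⌊ length xs /2⌋

flatten-pairUp : ∀ n (xs : List A) → length xs ≡ n + n → flatten (pairUp xs) ≡ xs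
flatten-pairUp zero    []           _  = refl
flatten-pairUp (suc n) (x ∷ [])     eq = contradiction (trans (suc-injective eq) (+-suc n n)) λ ()
flatten-pairUp (suc n) (x ∷ y ∷ xs) eq =
  cong (λ l → x ∷ y ∷ l) (flatten-pairUp n xs (suc-injective (trans (suc-injective eq) (+-suc n n))))

pairUp-edges : ∀ {R : A → A → Set} {xs} → Linked R xs → All (λ p → R (proj₁ p) (proj₂ p)) (pairUp xs)
pairUp-edges []              = []
pairUp-edges [-]             = []
pairUp-edges (r ∷ [-])       = r ∷ []
pairUp-edges (r ∷ _ ∷ links) = r ∷ pairUp-edges links

Linked-tabulate : ∀ {R : A → A → Set} {n} (f : Fin (suc n) → A) →
                  (∀ i → R (f (inject₁ i)) (f (suc i))) → Linked R (tabulate f)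
Linked-tabulate {n = zero}  f step = [-]
Linked-tabulate {n = suc n} f step = step zero ∷ Linked-tabulate (f ∘ suc) (step ∘ suc)

∈-pairUp-tabulate : ∀ {n} (f : Fin (suc n) → A) (i : Fin n) →
                    f (inject₁ i) ∈ flatten (pairUp (tabulate f))
∈-pairUp-tabulate f zero          = here refl
∈-pairUp-tabulate f (suc zero)    = there (here refl)
∈-pairUp-tabulate f (suc (suc i)) = there (there (∈-pairUp-tabulate (λ j → f (suc (suc j))) i))

crossPairs : A → A → List (B × B) → List ((A × B) × (A × B))
crossPairs x₁ x₂ []              = []
crossPairs x₁ x₂ ((y₁ , y₂) ∷ Q) = ((x₁ , y₁) , (x₂ , y₂)) ∷ ((x₁ , y₂) , (x₂ , y₁)) ∷ crossPairs x₁ x₂ Q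

_⊗_ : List (A × A) → List (B × B) → List ((A × B) × (A × B))
[]             ⊗ Q = []
((x₁ , x₂) ∷ P) ⊗ Q = crossPairs x₁ x₂ Q ++ (P ⊗ Q)

flatten-crossPairs-↭ : (x₁ x₂ : A) (Q : List (B × B)) →
  flatten (crossPairs x₁ x₂ Q) ↭ map (x₁ ,_) (flatten Q) ++ map (x₂ ,_) (flatten Q)
flatten-crossPairs-↭ x₁ x₂ []              = ↭-refl
flatten-crossPairs-↭ x₁ x₂ ((y₁ , y₂) ∷ Q) = begin
  (x₁ , y₁) ∷ (x₂ , y₂) ∷ (x₁ , y₂) ∷ (x₂ , y₁) ∷ flatten (crossPairs x₁ x₂ Q)
    ↭⟨ prep _ (swap _ _ (prep _ (flatten-crossPairs-↭ x₁ x₂ Q))) ⟩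
  (x₁ , y₁) ∷ (x₁ , y₂) ∷ (x₂ , y₂) ∷ (x₂ , y₁) ∷ ys₁ ++ ys₂
    ↭⟨ prep _ (prep _ (swap _ _ ↭-refl)) ⟩
  (x₁ , y₁) ∷ (x₁ , y₂) ∷ (x₂ , y₁) ∷ (x₂ , y₂) ∷ ys₁ ++ ys₂
    ↭⟨ prep _ (prep _ (shifts (_ ∷ _ ∷ []) ys₁)) ⟩
  (x₁ , y₁) ∷ (x₁ , y₂) ∷ ys₁ ++ (x₂ , y₁) ∷ (x₂ , y₂) ∷ ys₂ ∎
  where
  open PermutationReasoning
  ys₁ = map (x₁ ,_) (flatten Q)
  ys₂ = map (x₂ ,_) (flatten Q)

flatten-⊗-↭ : (P : List (A × A)) (Q : List (B × B)) →
              flatten (P ⊗ Q) ↭ cartesianProduct (flatten P) (flatten Q)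
flatten-⊗-↭ []              Q = ↭-refl
flatten-⊗-↭ ((x₁ , x₂) ∷ P) Q = begin
  flatten (crossPairs x₁ x₂ Q ++ P ⊗ Q)
    ≡⟨ flatten-++ (crossPairs x₁ x₂ Q) (P ⊗ Q) ⟩
  flatten (crossPairs x₁ x₂ Q) ++ flatten (P ⊗ Q)
    ↭⟨ ++⁺ (flatten-crossPairs-↭ x₁ x₂ Q) (flatten-⊗-↭ P Q) ⟩
  (map (x₁ ,_) (flatten Q) ++ map (x₂ ,_) (flatten Q)) ++ cartesianProduct (flatten P) (flatten Q)
    ≡⟨ ++-assoc (map (x₁ ,_) (flatten Q)) _ _ ⟩
  cartesianProduct (x₁ ∷ x₂ ∷ flatten P) (flatten Q) ∎
  where open PermutationReasoning

length-cartesianProduct : (xs : List A) (ys : List B) →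
                          length (cartesianProduct xs ys) ≡ length xs * length ys
length-cartesianProduct []       ys = refl
length-cartesianProduct (x ∷ xs) ys = begin
  length (map (x ,_) ys ++ cartesianProduct xs ys)     ≡⟨ length-++ (map (x ,_) ys) ⟩
  length (map (x ,_) ys) + length (cartesianProduct xs ys)
    ≡⟨ cong₂ _+_ (length-map (x ,_) ys) (length-cartesianProduct xs ys) ⟩
  length ys + length xs * length ys                    ∎
  where open ≡-Reasoning

length-⊗ : (P : List (A × A)) (Q : List (B × B)) →
           length (flatten (P ⊗ Q)) ≡ length (flatten P) * length (flatten Q)
length-⊗ P Q = trans (↭-length (flatten-⊗-↭ P Q)) (length-cartesianProduct (flatten P) (flatten Q))

∈-⊗⁻ : ∀ {z} (P : List (A × A)) (Q : List (B × B)) → z ∈ flatten (P ⊗ Q) →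
       proj₁ z ∈ flatten P × proj₂ z ∈ flatten Q
∈-⊗⁻ P Q m = ∈-cartesianProduct⁻ (flatten P) (flatten Q) (∈-resp-↭ (flatten-⊗-↭ P Q) m)

Any-⊗⁺ : ∀ {x y} (P : List (V G × V G)) (Q : List (V H × V H)) →
         Any (Adj G x) (flatten P) → Any (Adj H y) (flatten Q) →
         Any (Adj (G ×ᵍ H) (x , y)) (flatten (P ⊗ Q))
Any-⊗⁺ P Q p q = Any-resp-↭ (↭-sym (flatten-⊗-↭ P Q)) (cartesianProduct⁺ p q)

Unique-⊗ : (P : List (A × A)) (Q : List (B × B)) → Unique (flatten P) → Unique (flatten Q) →
           Unique (flatten (P ⊗ Q))
Unique-⊗ P Q uP uQ =
  Permutationₛ.Unique-resp-↭ (setoid _) (↭⇒↭ₛ (↭-sym (flatten-⊗-↭ P Q))) (Unique.cartesianProduct⁺ uP uQ)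

edges-⊗ : Symmetric H → (P : List (V G × V G)) (Q : List (V H × V H)) →
          All (Edge G) P → All (Edge H) Q → All (Edge (G ×ᵍ H)) (P ⊗ Q)
edges-⊗ symH []              Q []       eQ = []
edges-⊗ symH ((x₁ , x₂) ∷ P) Q (e ∷ eP) eQ = All.++⁺ (cross Q eQ) (edges-⊗ symH P Q eP eQ)
  where
  cross : ∀ Q → All (Edge _) Q → All (Edge _) (crossPairs x₁ x₂ Q)
  cross []              []        = []
  cross ((y₁ , y₂) ∷ Q) (e' ∷ eQ) = (e , e') ∷ (e , symH y₁ y₂ e') ∷ cross Q eQ

record Matching (G : Graph) (P : List (V G × V G)) : Set where
  field
    edges    : All (Edge G) P
    distinct : Unique (flatten P)
open Matching

pairUp-matching : ∀ {xs} → Linked (Adj G) xs → Unique xs → Matching G (pairUp xs)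
pairUp-matching links unique = record { edges = pairUp-edges links ; distinct = Unique-pairUp unique }

Matching-++ : ∀ {P Q} → Disjoint (flatten P) (flatten Q) →
              Matching G P → Matching G Q → Matching G (P ++ Q)
Matching-++ {P = P} {Q} disjoint mP mQ = record
  { edges    = All.++⁺ (edges mP) (edges mQ)
  ; distinct = subst Unique (sym (flatten-++ P Q)) (Unique.++⁺ (distinct mP) (distinct mQ) disjoint)
  }

Matching-⊗ : ∀ {P Q} → Symmetric H → Matching G P → Matching H Q → Matching (G ×ᵍ H) (P ⊗ Q)
Matching-⊗ {P = P} {Q} symH mP mQ = record
  { edges    = edges-⊗ symH P Q (edges mP) (edges mQ)
  ; distinct = Unique-⊗ P Q (distinct mP) (distinct mQ)
  }

γpr≤-matching : ∀ {P} → Matching G P → (∀ x → Any (Adj G x) (flatten P)) → γpr≤ G (length (flatten P))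
γpr≤-matching {P = P} mP dominated =
  record { pairs = P ; matched = edges mP ; distinct = distinct mP ; dominates = inj₂ ∘ dominated }
  , ≤-refl

γpr≤-mono : ∀ {m n} → m ≤ n → γpr≤ G m → γpr≤ G n
γpr≤-mono m≤n (D , size≤m) = D , ≤-trans size≤m m≤n

module _ (_≟_ : DecidableEquality A) where
  open DecMembership _≟_ using (_∈?_)

  injective⇒∃∉ : ∀ {m} (f : Fin m → A) → Injective _≡_ _≡_ f →
                 (L : List A) → length L < m → ∃ λ i → f i ∉ L
  injective⇒∃∉ {m} f f-injective L |L|<m =
    ¬∀⟶∃¬ m (λ i → f i ∈ L) (λ i → f i ∈? L) λ covered →
      <⇒≱ |L|<m (injective⇒≤ (position-injective covered))
    where
    position-injective : (covered : ∀ i → f i ∈ L) → Injective _≡_ _≡_ (index ∘ covered)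
    position-injective covered {i} {j} eq =
      f-injective (trans (lookup-index (covered i))
                         (trans (cong (lookupᴸ L) eq) (sym (lookup-index (covered j)))))

record Frame (G : Graph) (M d : ℕ) (j₀ : Fin M) (z : V G) : Set where
  field
    point    : Fin M → V G
    anchored : point j₀ ≡ z
    clique   : ∀ {i j} → i ≢ j → Adj G (point i) (point j)
    spread   : ∀ x → Σ (List (Fin M)) λ L → length L ≤ d × (∀ j → j ∉ L → Adj G x (point j))
open Frame

point-injective : ∀ {M d j₀ z} → Irreflexive G → (F : Frame G M d j₀ z) → Injective _≡_ _≡_ (point F)
point-injective {G = G} irr F {i} {j} eq with i ≟ᶠ j
... | yes i≡j = i≡j
... | no  i≢j = ⊥-elim (irr (point F i) (subst (Adj G (point F i)) (sym eq) (clique F i≢j)))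

transpose-injective : ∀ {n} (i j : Fin n) → Injective _≡_ _≡_ (PC.transpose i j)
transpose-injective i j {x} {y} eq = begin
  x                                      ≡⟨ PC.transpose-inverse j i ⟨
  PC.transpose j i (PC.transpose i j x)  ≡⟨ cong (PC.transpose j i) eq ⟩
  PC.transpose j i (PC.transpose i j y)  ≡⟨ PC.transpose-inverse j i ⟩
  y                                      ∎
  where open ≡-Reasoning

transpose-here : ∀ {n} (i j : Fin n) → PC.transpose i j i ≡ j
transpose-here i j rewrite dec-true (i ≟ᶠ i) refl = refl

K-frame : ∀ {M n} → M ≤ n → (j₀ : Fin M) (z : Fin n) → Frame (K n) M 1 j₀ z
K-frame {M} {n} M≤n j₀ z = record
  { point    = e
  ; anchored = transpose-here (embed j₀) z
  ; clique   = λ i≢j eq → i≢j (e-injective eq)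
  ; spread   = spread-at
  }
  where
  embed : Fin M → Fin n
  embed j = inject≤ j M≤n
  e : Fin M → Fin n
  e = PC.transpose (embed j₀) z ∘ embed
  e-injective : Injective _≡_ _≡_ e
  e-injective {i} {j} eq = inject≤-injective M≤n M≤n i j (transpose-injective (embed j₀) z eq)
  spread-at : ∀ x → Σ (List (Fin M)) λ L → length L ≤ 1 × (∀ j → j ∉ L → ¬ x ≡ e j)
  spread-at x with any? (λ j → e j ≟ᶠ x)
  ... | yes (j , ej≡x) =
    j ∷ [] , ≤-refl , λ i i∉ x≡ei → i∉ (here (e-injective (trans (sym x≡ei) (sym ej≡x))))
  ... | no  ∄j         = [] , z≤n , λ i _ x≡ei → ∄j (i , sym x≡ei)

×-frame : ∀ {M d e j₀ z z'} → Frame G M d j₀ z → Frame H M e j₀ z' → Frame (G ×ᵍ H) M (d + e) j₀ (z , z')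
×-frame {G = G} {H} {M} {d} {e} F F' = record
  { point    = point×
  ; anchored = cong₂ _,_ (anchored F) (anchored F')
  ; clique   = λ i≢j → clique F i≢j , clique F' i≢j
  ; spread   = spread×
  }
  where
  point× : Fin M → V (G ×ᵍ H)
  point× j = point F j , point F' j
  spread× : ∀ x → Σ (List (Fin M)) λ L → length L ≤ d + e × (∀ j → j ∉ L → Adj (G ×ᵍ H) x (point× j))
  spread× (x , x') with spread F x | spread F' x'
  ... | L , |L|≤d , adjL | L' , |L'|≤e , adjL' =
    L ++ L' , subst (_≤ d + e) (sym (length-++ L)) (+-mono-≤ |L|≤d |L'|≤e) ,
    λ j j∉ → adjL j (j∉ ∘ ∈-++⁺ˡ) , adjL' j (j∉ ∘ ∈-++⁺ʳ L)

KProd-frame : ∀ {k M} (ns : Vec ℕ (suc k)) → (∀ i → M ≤ lookup ns i) →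
              (j₀ : Fin M) (z : V (KProd ns)) → Frame (KProd ns) M (suc k) j₀ z
KProd-frame {zero}  (n ∷ [])  M≤ns j₀ z        = K-frame (M≤ns zero) j₀ z
KProd-frame {suc k} (n ∷ ns) M≤ns j₀ (z , zs) =
  ×-frame (K-frame (M≤ns zero) j₀ z) (KProd-frame ns (M≤ns ∘ suc) j₀ zs)

module _ (G : Graph) (z : V G) (ℓ : ℕ) where

  stem : Fin (suc ℓ) → V (attach G z ℓ)
  stem zero    = inj₁ z
  stem (suc i) = inj₂ i

  stemPairs : List (V (attach G z ℓ) × V (attach G z ℓ))
  stemPairs = pairUp (tabulate stem)

  stem-step : ∀ i → Adj (attach G z ℓ) (stem (inject₁ i)) (stem (suc i))
  stem-step zero    = refl , refl
  stem-step (suc i) = inj₁ (cong suc (sym (toℕ-inject₁ i)))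

  stem-injective : Injective _≡_ _≡_ stem
  stem-injective {zero}  {zero}  _  = refl
  stem-injective {suc i} {suc j} eq = cong suc (inj₂-injective eq)

  stemPairs-matching : Matching (attach G z ℓ) stemPairs
  stemPairs-matching = pairUp-matching (Linked-tabulate stem stem-step) (Unique.tabulate⁺ stem-injective)

  stemPairs-dominate : Symmetric G → ∀ i → Any (Adj (attach G z ℓ) (inj₂ i)) (flatten stemPairs)
  stemPairs-dominate symG i =
    lose (∈-pairUp-tabulate stem i) (attach-symmetric symG (stem (inject₁ i)) (inj₂ i) (stem-step i))

  stemPairs-ground : ∀ {g} → inj₁ g ∈ flatten stemPairs → g ≡ z
  stemPairs-ground m with ∈-tabulate⁻ {f = stem} (∈-pairUp⁻ (tabulate stem) m)
  ... | zero  , eq = inj₁-injective eq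
  ... | suc _ , ()

  length-stemPairs : length (flatten stemPairs) ≡ ⌈ ℓ /2⌉ + ⌈ ℓ /2⌉
  length-stemPairs =
    trans (length-pairUp (tabulate stem)) (cong (λ n → ⌊ n /2⌋ + ⌊ n /2⌋) (length-tabulate stem))

module _ (G : Graph) (z : V G) (ℓ k : ℕ) {d j₀ y} (F : Frame G (3 + (k + k)) d j₀ y) where

  innerPoint : Fin (k + k) → V (attach G z ℓ)
  innerPoint i = inj₁ (point F (3 ↑ʳ i))

  innerPairs : List (V (attach G z ℓ) × V (attach G z ℓ))
  innerPairs = pairUp (tabulate innerPoint)

  flatten-innerPairs : flatten innerPairs ≡ tabulate innerPoint
  flatten-innerPairs = flatten-pairUp k (tabulate innerPoint) (length-tabulate innerPoint)

  length-innerPairs : length (flatten innerPairs) ≡ k + k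
  length-innerPairs = trans (cong length flatten-innerPairs) (length-tabulate innerPoint)

  innerPairs-matching : Irreflexive G → Matching (attach G z ℓ) innerPairs
  innerPairs-matching irr = pairUp-matching
    (AllPairs⇒Linked (AllPairs.tabulate⁺ λ i≢j → clique F (i≢j ∘ ↑ʳ-injective 3 _ _)))
    (Unique.tabulate⁺ (↑ʳ-injective 3 _ _ ∘ point-injective irr F ∘ inj₁-injective))

  innerPairs-dominate : d < k + k → ∀ g → Any (Adj (attach G z ℓ) (inj₁ g)) (flatten innerPairs)
  innerPairs-dominate d<k+k g with spread F g
  ... | L , |L|≤d , adjL with injective⇒∃∉ _≟ᶠ_ (3 ↑ʳ_) (↑ʳ-injective 3 _ _) L (≤-<-trans |L|≤d d<k+k)
  ...   | i , i∉L = subst (Any _) (sym flatten-innerPairs) (Any.tabulate⁺ i (adjL (3 ↑ʳ i) i∉L))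

  ∈-innerPairs⁻ : ∀ {x} → x ∈ flatten innerPairs → ∃ λ i → x ≡ innerPoint i
  ∈-innerPairs⁻ {x} m = ∈-tabulate⁻ (subst (x ∈_) flatten-innerPairs m)

pairedBound : ℕ → ℕ → ℕ → ℕ
pairedBound k x y = (4 + (k + k)) + ((k + k + (x + x)) * (y + y) + (x + x) * (k + k))

module Construction (G : Graph) (symG : Symmetric G) (irrG : Irreflexive G) (k : ℕ) (2≤k : 2 ≤ k)
                    (frame : ∀ j₀ z → Frame G (3 + (k + k)) (suc k) j₀ z) (u v : V G) (a b : ℕ) where

  Gᵃ Gᵇ : Graph
  Gᵃ = attach G u a
  Gᵇ = attach G v b

  Fα : Frame G (3 + (k + k)) (suc k) (suc zero) u
  Fα = frame (suc zero) u
  Fβ : Frame G (3 + (k + k)) (suc k) (suc (suc zero)) v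
  Fβ = frame (suc (suc zero)) v

  α β : Fin (3 + (k + k)) → V G
  α = point Fα
  β = point Fβ

  α-injective : Injective _≡_ _≡_ α
  α-injective = point-injective irrG Fα
  β-injective : Injective _≡_ _≡_ β
  β-injective = point-injective irrG Fβ

  k<k+k : suc k < k + k
  k<k+k = ≤-trans (≤-reflexive (+-comm 2 k)) (+-monoʳ-≤ k 2≤k)

  -- α is anchored at index 1, β at index 2, and the inner pairs use the indices from 3 on.  So a
  -- diagonal vertex (α j, β j) meets the ground part of P₁ only if j = 2 and that of P₂ only if
  -- j = 1, and then its other coordinate lies outside the block; (α 2, β 1) avoids both blocks
  -- and makes the list even.
  diagonal : Fin (3 + (k + k)) → V (Gᵃ ×ᵍ Gᵇ)
  diagonal j = inj₁ (α j) , inj₁ (β j)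

  extra : V (Gᵃ ×ᵍ Gᵇ)
  extra = inj₁ (α (suc (suc zero))) , inj₁ (β (suc zero))

  Z : List (V (Gᵃ ×ᵍ Gᵇ) × V (Gᵃ ×ᵍ Gᵇ))
  Z = pairUp (extra ∷ tabulate diagonal)

  Rᵃ Iᵃ S₁ : List (V Gᵃ × V Gᵃ)
  Rᵃ = stemPairs G u a
  Iᵃ = innerPairs G u a k Fα
  S₁ = Iᵃ ++ Rᵃ

  Rᵇ Iᵇ : List (V Gᵇ × V Gᵇ)
  Rᵇ = stemPairs G v b
  Iᵇ = innerPairs G v b k Fβ

  P₁ P₂ D : List (V (Gᵃ ×ᵍ Gᵇ) × V (Gᵃ ×ᵍ Gᵇ))
  P₁ = S₁ ⊗ Rᵇ
  P₂ = Rᵃ ⊗ Iᵇ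
  D  = Z ++ (P₁ ++ P₂)

  flatten-Z : flatten Z ≡ extra ∷ tabulate diagonal
  flatten-Z = flatten-pairUp (2 + k) _ (trans (cong suc (length-tabulate diagonal)) (even k))
    where
    even : ∀ k → suc (3 + (k + k)) ≡ (2 + k) + (2 + k)
    even = solve-∀

  Z-matching : Matching (Gᵃ ×ᵍ Gᵇ) Z
  Z-matching = pairUp-matching
    ((clique Fα (λ ()) , clique Fβ (λ ())) ∷ AllPairs⇒Linked (AllPairs.tabulate⁺ diagonal-clique))
    (All.tabulate⁺ extra≢diagonal ∷ Unique.tabulate⁺ diagonal-injective)
    where
    diagonal-clique : ∀ {i j} → i ≢ j → Adj (Gᵃ ×ᵍ Gᵇ) (diagonal i) (diagonal j)
    diagonal-clique i≢j = clique Fα i≢j , clique Fβ i≢j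
    diagonal-injective : Injective _≡_ _≡_ diagonal
    diagonal-injective eq = α-injective (inj₁-injective (cong proj₁ eq))
    extra≢diagonal : ∀ j → extra ≢ diagonal j
    extra≢diagonal j eq
      with α-injective (inj₁-injective (cong proj₁ eq)) | β-injective (inj₁-injective (cong proj₂ eq))
    ... | refl | ()

  Z-dominates : ∀ g g' → Any (Adj (Gᵃ ×ᵍ Gᵇ) (inj₁ g , inj₁ g')) (flatten Z)
  Z-dominates g g' with spread Fα g | spread Fβ g'
  ... | L , |L|≤ , adjL | L' , |L'|≤ , adjL' with injective⇒∃∉ _≟ᶠ_ id id (L ++ L') |L++L'|<
    where
    |L++L'|< : length (L ++ L') < 3 + (k + k)
    |L++L'|< = subst (_< 3 + (k + k)) (sym (length-++ L))
      (≤-<-trans (+-mono-≤ |L|≤ |L'|≤) (s≤s (s≤s (≤-reflexive (+-suc k k)))))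
  ... | j , j∉ = subst (Any _) (sym flatten-Z)
    (there (Any.tabulate⁺ {f = diagonal} j (adjL j (j∉ ∘ ∈-++⁺ˡ) , adjL' j (j∉ ∘ ∈-++⁺ʳ L))))

  stem-α : ∀ {j} → inj₁ (α j) ∈ flatten Rᵃ → j ≡ suc zero
  stem-α m = α-injective (trans (stemPairs-ground G u a m) (sym (anchored Fα)))

  stem-β : ∀ {j} → inj₁ (β j) ∈ flatten Rᵇ → j ≡ suc (suc zero)
  stem-β m = β-injective (trans (stemPairs-ground G v b m) (sym (anchored Fβ)))

  α₂∉S₁ : inj₁ (α (suc (suc zero))) ∉ flatten S₁
  α₂∉S₁ m with ∈-flatten-++⁻ Iᵃ Rᵃ m
  ... | inj₁ m-inner with ∈-innerPairs⁻ G u a k Fα m-inner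
  ...   | i , eq with α-injective (inj₁-injective eq)
  ...     | ()
  α₂∉S₁ m | inj₂ m-stem with stem-α m-stem
  ... | ()

  β₁∉inner : inj₁ (β (suc zero)) ∉ flatten Iᵇ
  β₁∉inner m with ∈-innerPairs⁻ G v b k Fβ m
  ... | i , eq with β-injective (inj₁-injective eq)
  ...   | ()

  S₁-matching : Matching Gᵃ S₁
  S₁-matching = Matching-++ inner#stem (innerPairs-matching G u a k Fα irrG) (stemPairs-matching G u a)
    where
    inner#stem : Disjoint (flatten Iᵃ) (flatten Rᵃ)
    inner#stem (m-inner , m-stem) with ∈-innerPairs⁻ G u a k Fα m-inner
    ... | i , refl with stem-α m-stem
    ...   | ()

  S₁-dominates : ∀ x → Any (Adj Gᵃ x) (flatten S₁)
  S₁-dominates (inj₁ g) = Any-flatten-++⁺ˡ Iᵃ Rᵃ (innerPairs-dominate G u a k Fα k<k+k g)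
  S₁-dominates (inj₂ i) = Any-flatten-++⁺ʳ Iᵃ Rᵃ (stemPairs-dominate G u a symG i)

  P₁#P₂ : Disjoint (flatten P₁) (flatten P₂)
  P₁#P₂ (m₁ , m₂) with ∈-innerPairs⁻ G v b k Fβ (proj₂ (∈-⊗⁻ Rᵃ Iᵇ m₂))
  ... | i , eq with stem-β (subst (_∈ flatten Rᵇ) eq (proj₂ (∈-⊗⁻ S₁ Rᵇ m₁)))
  ...   | ()

  ∈-Z⁻ : ∀ {x} → x ∈ flatten Z → x ≡ extra ⊎ ∃ λ j → x ≡ diagonal j
  ∈-Z⁻ {x} m with subst (x ∈_) flatten-Z m
  ... | here eq = inj₁ eq
  ... | there m' = inj₂ (∈-tabulate⁻ m')

  Z#P₁₂ : Disjoint (flatten Z) (flatten (P₁ ++ P₂))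
  Z#P₁₂ (mZ , mP) with ∈-Z⁻ mZ | ∈-flatten-++⁻ P₁ P₂ mP
  ... | inj₁ refl | inj₁ m₁ with stem-β (proj₂ (∈-⊗⁻ S₁ Rᵇ m₁))
  ...   | ()
  Z#P₁₂ (mZ , mP) | inj₁ refl | inj₂ m₂ with stem-α (proj₁ (∈-⊗⁻ Rᵃ Iᵇ m₂))
  ...   | ()
  Z#P₁₂ (mZ , mP) | inj₂ (j , refl) | inj₁ m₁ with stem-β (proj₂ (∈-⊗⁻ S₁ Rᵇ m₁))
  ...   | refl = α₂∉S₁ (proj₁ (∈-⊗⁻ S₁ Rᵇ m₁))
  Z#P₁₂ (mZ , mP) | inj₂ (j , refl) | inj₂ m₂ with stem-α (proj₁ (∈-⊗⁻ Rᵃ Iᵇ m₂))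
  ...   | refl = β₁∉inner (proj₂ (∈-⊗⁻ Rᵃ Iᵇ m₂))

  D-matching : Matching (Gᵃ ×ᵍ Gᵇ) D
  D-matching = Matching-++ Z#P₁₂ Z-matching (Matching-++ P₁#P₂
    (Matching-⊗ (attach-symmetric symG) S₁-matching (stemPairs-matching G v b))
    (Matching-⊗ (attach-symmetric symG) (stemPairs-matching G u a)
                                        (innerPairs-matching G v b k Fβ irrG)))

  D-dominates : ∀ x → Any (Adj (Gᵃ ×ᵍ Gᵇ) x) (flatten D)
  D-dominates (inj₁ g , inj₁ g') = Any-flatten-++⁺ˡ Z (P₁ ++ P₂) (Z-dominates g g')
  D-dominates (x , inj₂ j) = Any-flatten-++⁺ʳ Z (P₁ ++ P₂) (Any-flatten-++⁺ˡ P₁ P₂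
    (Any-⊗⁺ {G = Gᵃ} {H = Gᵇ} {x} {inj₂ j} S₁ Rᵇ
            (S₁-dominates x) (stemPairs-dominate G v b symG j)))
  D-dominates (inj₂ i , inj₁ g') = Any-flatten-++⁺ʳ Z (P₁ ++ P₂) (Any-flatten-++⁺ʳ P₁ P₂
    (Any-⊗⁺ {G = Gᵃ} {H = Gᵇ} {inj₂ i} {inj₁ g'} Rᵃ Iᵇ
            (stemPairs-dominate G u a symG i) (innerPairs-dominate G v b k Fβ k<k+k g')))

  length-D : length (flatten D) ≡ pairedBound k ⌈ a /2⌉ ⌈ b /2⌉
  length-D = begin
    length (flatten (Z ++ (P₁ ++ P₂)))
      ≡⟨ length-flatten-++ Z (P₁ ++ P₂) ⟩
    length (flatten Z) + length (flatten (P₁ ++ P₂))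
      ≡⟨ cong₂ _+_ (cong length flatten-Z) (length-flatten-++ P₁ P₂) ⟩
    suc (length (tabulate diagonal)) + (length (flatten P₁) + length (flatten P₂))
      ≡⟨ cong₂ _+_ (cong suc (length-tabulate diagonal))
                   (cong₂ _+_ (length-⊗ S₁ Rᵇ) (length-⊗ Rᵃ Iᵇ)) ⟩
    4 + (k + k) + (length (flatten S₁) * length (flatten Rᵇ)
                   + length (flatten Rᵃ) * length (flatten Iᵇ))
      ≡⟨ cong (λ n → 4 + (k + k) + n) (cong₂ _+_
           (cong₂ _*_ (trans (length-flatten-++ Iᵃ _)
                             (cong₂ _+_ (length-innerPairs G u a k Fα) (length-stemPairs G u a)))
                      (length-stemPairs G v b))
           (cong₂ _*_ (length-stemPairs G u a) (length-innerPairs G v b k Fβ))) ⟩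
    pairedBound k ⌈ a /2⌉ ⌈ b /2⌉ ∎
    where open ≡-Reasoning

  γpr-bound : γpr≤ (Gᵃ ×ᵍ Gᵇ) (pairedBound k ⌈ a /2⌉ ⌈ b /2⌉)
  γpr-bound = subst (γpr≤ (Gᵃ ×ᵍ Gᵇ)) length-D (γpr≤-matching D-matching D-dominates)

n<2^n : ∀ n → n < 2 ^ n
n<2^n zero    = s≤s z≤n
n<2^n (suc n) = begin
  suc (suc n)    ≡⟨ cong suc (+-comm 1 n) ⟩
  suc n + 1      ≤⟨ +-mono-≤ (n<2^n n) (m^n>0 2 n) ⟩
  2 ^ n + 2 ^ n  ≡⟨ cong (2 ^ n +_) (sym (+-identityʳ (2 ^ n))) ⟩
  2 ^ suc n      ∎
  where open ≤-Reasoning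

2*n≤2^n*n : ∀ n → 2 * n ≤ 2 ^ n * n
2*n≤2^n*n zero    = z≤n
2*n≤2^n*n (suc n) = *-monoˡ-≤ (suc n) (*-monoʳ-≤ 2 (m^n>0 2 n))

pairedBound-mono : ∀ k {x x' y y'} → x ≤ x' → y ≤ y' → pairedBound k x y ≤ pairedBound k x' y'
pairedBound-mono k x≤x' y≤y' = +-monoʳ-≤ (4 + (k + k))
  (+-mono-≤ (*-mono-≤ (+-monoʳ-≤ (k + k) 2x≤2x') (+-mono-≤ y≤y' y≤y')) (*-monoˡ-≤ (k + k) 2x≤2x'))
  where 2x≤2x' = +-mono-≤ x≤x' x≤x'

-- The right side has only 3 a k + a² k against the 4 a k of pairedBound; a k ≤ a² k closes the gap.
pairedBound-≤-polynomial : ∀ k a b →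
  pairedBound k a b ≤ (1 + a + b) * ((a + 2) * suc k + 2 * a + 2) + 2 * b * (suc k + a + 2)
pairedBound-≤-polynomial k a b = +-cancelʳ-≤ (a * k) _ _ (begin
  pairedBound k a b + a * k            ≤⟨ +-monoʳ-≤ (pairedBound k a b) (ak≤aak a) ⟩
  pairedBound k a b + a * a * k        ≤⟨ m≤m+n _ (7 * a + 3 * (a * a) + a * b * k + a * b + 10 * b) ⟩
  pairedBound k a b + a * a * k + (7 * a + 3 * (a * a) + a * b * k + a * b + 10 * b)
                                       ≡⟨ identity k a b ⟩
  (1 + a + b) * ((a + 2) * suc k + 2 * a + 2) + 2 * b * (suc k + a + 2) + a * k ∎)
  where
  open ≤-Reasoning
  ak≤aak : ∀ a → a * k ≤ a * a * k
  ak≤aak zero    = z≤n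
  ak≤aak (suc a) = subst (suc a * k ≤_) (sym (*-assoc (suc a) (suc a) k)) (m≤n*m (suc a * k) (suc a))
  identity : ∀ k a b → 4 + (k + k) + ((k + k + (a + a)) * (b + b) + (a + a) * (k + k))
                       + a * a * k + (7 * a + 3 * (a * a) + a * b * k + a * b + 10 * b)
                     ≡ (1 + a + b) * ((a + 2) * suc k + 2 * a + 2) + 2 * b * (suc k + a + 2) + a * k
  identity = solve-∀

pairedBound-≤ : ∀ k a b → pairedBound k ⌈ a /2⌉ ⌈ b /2⌉
                        ≤ 2 ^ (a + b) * ((a + 2) * suc k + 2 * a + 2) + 2 ^ b * b * (suc k + a + 2)
pairedBound-≤ k a b = begin
  pairedBound k ⌈ a /2⌉ ⌈ b /2⌉  ≤⟨ pairedBound-mono k (⌈n/2⌉≤n a) (⌈n/2⌉≤n b) ⟩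
  pairedBound k a b              ≤⟨ pairedBound-≤-polynomial k a b ⟩
  (1 + a + b) * c + 2 * b * d    ≤⟨ +-mono-≤ (*-monoˡ-≤ c (n<2^n (a + b))) (*-monoˡ-≤ d (2*n≤2^n*n b)) ⟩
  2 ^ (a + b) * c + 2 ^ b * b * d ∎
  where
  open ≤-Reasoning
  c = (a + 2) * suc k + 2 * a + 2
  d = suc k + a + 2

lemma8 : (k : ℕ) (ns : Vec ℕ (suc k)) → 3 ≤ suc k
    → (∀ i → 2 * suc k + 1 ≤ lookup ns i)
    → (u v : V (KProd ns)) (a b : ℕ)
    → γpr≤ (attach (KProd ns) u a ×ᵍ attach (KProd ns) v b)
    (2 ^ (a + b) * ((a + 2) * suc k + 2 * a + 2) + 2 ^ b * b * (suc k + a + 2))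
lemma8 k ns 3≤t 2t+1≤ns u v a b = γpr≤-mono (pairedBound-≤ k a b)
  (Construction.γpr-bound (KProd ns) (KProd-symmetric ns) (KProd-irreflexive ns) k (s≤s⁻¹ 3≤t)
                          (KProd-frame ns M≤ns) u v a b)
  where
  M≤ns : ∀ i → 3 + (k + k) ≤ lookup ns i
  M≤ns i = subst (_≤ lookup ns i) (2t+1≡ k) (2t+1≤ns i)
    where
    2t+1≡ : ∀ k → 2 * suc k + 1 ≡ 3 + (k + k)
    2t+1≡ = solve-∀
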